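{- Let $\omega\in\mathfrak{S}_n$, let $g$ be a nonnegative integer, and let $\prec$ be a total ordering $i_1\prec i_2\prec\cdots\prec i_n$ of $[n]$. For $1\le j\le n-1$ let $\prec_j$ be the ordering obtained from $\prec$ by swapping $i_j$ and $i_{j+1}$. Then for every integer $1\le j\le n-1$ there exists a bijection $\Lambda_j:\mathcal{M}^{\prec}_g(\omega)\to\mathcal{M}^{\prec_j}_g(\omega)$.
   Context: Permutations in $\mathfrak{S}_n$ are multiplied from left to right; $c(\omega)$ is the number of cycles of $\omega$. For a total order $\prec$ on $[n]$, a genus $g$ monotone factorisation of $\omega$ relative to $\prec$ is a tuple of transpositions $((a_1\,b_1),\dots,(a_m\,b_m))$ with $(a_1\,b_1)\cdots(a_m\,b_m)=\omega$, such that $m=n-c(\omega)+2g$, each transposition is written with $a_r\prec b_r$, and $b_1\preceq b_2\preceq\cdots\preceq b_m$. $\mathcal{M}^{\prec}_g(\omega)$ denotes the set of these factorisations. -}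

module Defs where

open import Data.Nat using (ℕ; zero; suc; _+_; _*_; _∸_; _≤_; _<_; _≤?_)
open import Data.Fin using (Fin; toℕ)
open import Data.Fin.Properties using (all?)
open import Data.Fin.Permutation using (Permutation′; _⟨$⟩ʳ_; _⟨$⟩ˡ_; _∘ₚ_; id; transpose)
open import Data.List using (List; []; _∷_; length; map; foldr; filter; allFin)
open import Data.List.Relation.Unary.All using (All)
open import Data.List.Relation.Unary.Linked using (Linked)
open import Data.Product using (Σ; _×_; _,_; proj₁; proj₂)
open import Relation.Binary.PropositionalEquality using (_≡_)
open import Relation.Binary.Bundles using (Setoid)
import Relation.Binary.PropositionalEquality as ≡
import Relation.Binary.Construct.On as On
open import Function.Bundles using (Bijection)

iter : ∀ {n} → Permutation′ n → ℕ → Fin n → Fin n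
iter ω zero    i = i
iter ω (suc k) i = iter ω k (ω ⟨$⟩ʳ i)

-- i is the (numerically) smallest element of its cycle under ω
-- (every orbit has size ≤ n, so exponents k < n suffice)
-- c(ω) = number of cycles = number of cycle minima
cycles : ∀ {n} → Permutation′ n → ℕ
cycles {n} ω =
  length (filter (λ i → all? (λ (k : Fin n) → toℕ i ≤? toℕ (iter ω (toℕ k) i))) (allFin n))

-- A total order ≺ on [n] is given by its listing i₁ ≺ i₂ ≺ ⋯ ≺ iₙ,
-- i.e. a bijection seq : positions → elements, with i_k = seq ⟨$⟩ʳ k.
Order : ℕ → Set
Order n = Permutation′ n

rank : ∀ {n} → Order n → Fin n → ℕ
rank seq a = toℕ (seq ⟨$⟩ˡ a)

_≺[_]_ : ∀ {n} → Fin n → Order n → Fin n → Set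
a ≺[ seq ] b = rank seq a < rank seq b

_⪯[_]_ : ∀ {n} → Fin n → Order n → Fin n → Set
a ⪯[ seq ] b = rank seq a ≤ rank seq b

swapOrder : ∀ {n} → Order n → Fin n → Fin n → Order n
swapOrder seq j k = transpose j k ∘ₚ seq

Factorisation : ℕ → Set
Factorisation n = List (Fin n × Fin n)

-- product (a₁ b₁)⋯(a_m b_m), multiplied left to right
-- (π₁ ∘ₚ π₂ applies π₁ first, then π₂)
prod : ∀ {n} → Factorisation n → Permutation′ n
prod = foldr (λ p π → transpose (proj₁ p) (proj₂ p) ∘ₚ π) id

record IsMonotoneFact {n} (seq : Order n) (g : ℕ) (ω : Permutation′ n)
                      (f : Factorisation n) : Set where
  field
    product : ∀ i → prod f ⟨$⟩ʳ i ≡ ω ⟨$⟩ʳ i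
    len     : length f ≡ n ∸ cycles ω + 2 * g
    ordered : All (λ p → proj₁ p ≺[ seq ] proj₂ p) f
    monotone : Linked (λ p q → proj₂ p ⪯[ seq ] proj₂ q) f

-- 𝓜^≺_g(ω) as a set: factorisations together with the proof that they
-- qualify; two elements are equal iff the underlying tuples are equal.
𝓜 : ∀ {n} → Order n → ℕ → Permutation′ n → Setoid _ _
𝓜 {n} seq g ω = On.setoid (≡.setoid (Factorisation n))
                  (proj₁ {B = IsMonotoneFact seq g ω})

{-# OPTIONS --safe #-}
module Submission where

-- Write a, b for i_j, i_{j+1}. In a monotone factorisation only the middle block X Y, where X
-- consists of the factors (x a) and Y of the factors (y b), notices the swap: the factors before
-- and after it are monotone for ≺_j as well. If (a b) occurs in Y, split Y = Y₁ (a b) H at its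
-- last occurrence (otherwise put Z = X, H = Y). Moving (a b) to the front of Y₁ conjugates Y₁
-- by (a b), so X Y = Z H where Z = X (b a) Y₁^(a b) consists of factors (z a) and H of factors
-- (h b) with h ≺ a. Moving Z past H conjugates it by the product of H, which fixes a, and H Z^H
-- is a middle block for ≺_j. Both steps preserve the product and the length and can be undone;
-- undoing the first one splits Z at its first (b a).

open import Defs
open import Data.Nat using (ℕ; suc; _+_; _≤_; _<_; _<?_; s≤s⁻¹)
open import Data.Nat.Properties
  using ( ≤-refl; ≤-reflexive; ≤-trans; ≤-antisym; <⇒≤; <⇒≢; >⇒≢; <-trans; <-irrefl; ≮⇒≥; ≤⇒≯
        ; n≤1+n; n<1+n; m≤n+m; m<n⇒m<1+n; m<1+n⇒m<n∨m≡n)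
open import Data.Fin using (Fin; toℕ)
open import Data.Fin.Properties using (_≟_; toℕ-injective)
open import Data.Fin.Permutation
  using (Permutation′; _⟨$⟩ʳ_; _⟨$⟩ˡ_; _∘ₚ_; _≈_; flip; transpose; inverseˡ; inverseʳ)
open import Data.Fin.Permutation.Components using (transpose-inverse)
open import Data.List using (List; []; _∷_; _++_; map; length; takeWhile; dropWhile)
open import Data.List.Properties
  using (length-++; length-++-comm; length-map; ++-assoc; takeWhile++dropWhile)
open import Data.List.Relation.Unary.All as All using (All; []; _∷_)
open import Data.List.Relation.Unary.All.Properties
  using (map⁺; ++⁺; ++⁻ˡ; ++⁻ʳ; all-takeWhile; takeWhile⁺; dropWhile⁺)
open import Data.List.Relation.Unary.Linked as Linked using (Linked; []; [-]; _∷_)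
open import Data.List.Relation.Unary.Linked.Properties using (Linked⇒All)
open import Data.Maybe as Maybe using (Maybe; just; nothing)
open import Data.Product using (_×_; _,_; proj₁; proj₂; map₁; uncurry)
open import Data.Product.Properties using (≡-dec)
open import Data.Sum as Sum using (inj₁; inj₂)
open import Function using (_∘_; _on_)
open import Function.Bundles using (Bijection; Injection)
open import Function.Properties.Inverse using (↔⇒↣; Inverse⇒Bijection)
open import Relation.Binary.Core using (Rel)
open import Relation.Binary.Definitions using (DecidableEquality)
open import Relation.Binary.PropositionalEquality
  using (_≡_; _≢_; refl; sym; trans; cong; cong₂; subst; subst₂; module ≡-Reasoning)
open import Relation.Nullary using (¬_; yes; no; contradiction)
open import Relation.Nullary.Decidable using (dec-true; dec-false)
open import Relation.Unary using (Pred; _∪_; ｛_｝)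

module _ {n : ℕ} where

  transpose-matchˡ : (x y : Fin n) → transpose x y ⟨$⟩ʳ x ≡ y
  transpose-matchˡ x y rewrite dec-true (x ≟ x) refl = refl

  transpose-matchʳ : (x y : Fin n) → transpose x y ⟨$⟩ʳ y ≡ x
  transpose-matchʳ x y with y ≟ x
  ... | yes refl = refl
  ... | no _ rewrite dec-true (y ≟ y) refl = refl

  transpose-fix : {x y z : Fin n} → z ≢ x → z ≢ y → transpose x y ⟨$⟩ʳ z ≡ z
  transpose-fix {x} {y} {z} z≢x z≢y
    rewrite dec-false (z ≟ x) z≢x | dec-false (z ≟ y) z≢y = refl

  data Position (x y z : Fin n) : Set where
    at-x      : z ≡ x → Position x y z
    at-y      : z ≡ y → Position x y z
    elsewhere : z ≢ x → z ≢ y → Position x y z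

  position : (x y z : Fin n) → Position x y z
  position x y z with z ≟ x | z ≟ y
  ... | yes z≡x | _       = at-x z≡x
  ... | no _    | yes z≡y = at-y z≡y
  ... | no z≢x  | no z≢y  = elsewhere z≢x z≢y

  transpose-comm : (x y : Fin n) → transpose x y ≈ transpose y x
  transpose-comm x y z with position x y z
  ... | at-x refl = trans (transpose-matchˡ z y) (sym (transpose-matchʳ y z))
  ... | at-y refl = trans (transpose-matchʳ x z) (sym (transpose-matchˡ z x))
  ... | elsewhere z≢x z≢y = trans (transpose-fix z≢x z≢y) (sym (transpose-fix z≢y z≢x))

  transpose-conjugate : (π : Permutation′ n) (x y z : Fin n) →
    transpose (π ⟨$⟩ʳ x) (π ⟨$⟩ʳ y) ⟨$⟩ʳ (π ⟨$⟩ʳ z) ≡ π ⟨$⟩ʳ (transpose x y ⟨$⟩ʳ z)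
  transpose-conjugate π x y z with position x y z
  ... | at-x refl =
    trans (transpose-matchˡ (π ⟨$⟩ʳ z) (π ⟨$⟩ʳ y)) (cong (π ⟨$⟩ʳ_) (sym (transpose-matchˡ z y)))
  ... | at-y refl =
    trans (transpose-matchʳ (π ⟨$⟩ʳ x) (π ⟨$⟩ʳ z)) (cong (π ⟨$⟩ʳ_) (sym (transpose-matchʳ x z)))
  ... | elsewhere z≢x z≢y =
    trans (transpose-fix (z≢x ∘ injective) (z≢y ∘ injective))
          (cong (π ⟨$⟩ʳ_) (sym (transpose-fix z≢x z≢y)))
    where injective = Injection.injective (↔⇒↣ π)

  transpose-preserves : ∀ {ℓ} (Q : Pred (Fin n) ℓ) {x y z} → Q x → Q y → Q z →
                        Q (transpose x y ⟨$⟩ʳ z)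
  transpose-preserves Q {x} {y} {z} qx qy qz with position x y z
  ... | at-x refl = subst Q (sym (transpose-matchˡ z y)) qy
  ... | at-y refl = subst Q (sym (transpose-matchʳ x z)) qx
  ... | elsewhere z≢x z≢y = subst Q (sym (transpose-fix z≢x z≢y)) qz

-- Words of transpositions

_▹_ : ∀ {n ℓ} → Pred (Fin n) ℓ → Fin n → Pred (Fin n × Fin n) ℓ
(Q ▹ c) p = Q (proj₁ p) × proj₂ p ≡ c

module _ {n : ℕ} where
  open ≡-Reasoning

  prod-++ : (u v : Factorisation n) → prod (u ++ v) ≈ prod u ∘ₚ prod v
  prod-++ []      v i = refl
  prod-++ (_ ∷ u) v i = prod-++ u v _

  prod-++-cong : {u u′ v v′ : Factorisation n} → prod u ≈ prod u′ → prod v ≈ prod v′ →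
                 prod (u ++ v) ≈ prod (u′ ++ v′)
  prod-++-cong {u} {u′} {v} {v′} u≈u′ v≈v′ i = begin
    prod (u ++ v) ⟨$⟩ʳ i           ≡⟨ prod-++ u v i ⟩
    prod v ⟨$⟩ʳ (prod u ⟨$⟩ʳ i)    ≡⟨ cong (prod v ⟨$⟩ʳ_) (u≈u′ i) ⟩
    prod v ⟨$⟩ʳ (prod u′ ⟨$⟩ʳ i)   ≡⟨ v≈v′ _ ⟩
    prod v′ ⟨$⟩ʳ (prod u′ ⟨$⟩ʳ i)  ≡⟨ sym (prod-++ u′ v′ i) ⟩
    prod (u′ ++ v′) ⟨$⟩ʳ i         ∎

  prod-cong-middle : (u : Factorisation n) {v v′ : Factorisation n} (w : Factorisation n) →
                     prod v ≈ prod v′ → prod (u ++ v ++ w) ≈ prod (u ++ v′ ++ w)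
  prod-cong-middle u {v} {v′} w v≈v′ =
    prod-++-cong {u = u} {u′ = u} (λ _ → refl)
                 (prod-++-cong {u = v} {u′ = v′} {v = w} {v′ = w} v≈v′ (λ _ → refl))

  length-cong-middle : (u : Factorisation n) {v v′ : Factorisation n} (w : Factorisation n) →
                       length v ≡ length v′ → length (u ++ v ++ w) ≡ length (u ++ v′ ++ w)
  length-cong-middle u {v} {v′} w |v|≡|v′| = begin
    length (u ++ v ++ w)              ≡⟨ length-++ u ⟩
    length u + length (v ++ w)        ≡⟨ cong (length u +_) (length-++ v) ⟩
    length u + (length v + length w)  ≡⟨ cong (λ k → length u + (k + length w)) |v|≡|v′| ⟩
    length u + (length v′ + length w) ≡⟨ cong (length u +_) (sym (length-++ v′)) ⟩
    length u + length (v′ ++ w)       ≡⟨ sym (length-++ u) ⟩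
    length (u ++ v′ ++ w)             ∎

  conjugate : Permutation′ n → Factorisation n → Factorisation n
  conjugate π = map (λ p → π ⟨$⟩ʳ proj₁ p , π ⟨$⟩ʳ proj₂ p)

  prod-conjugate : (π : Permutation′ n) (w : Factorisation n) →
                   π ∘ₚ prod (conjugate π w) ≈ prod w ∘ₚ π
  prod-conjugate π []      i = refl
  prod-conjugate π (p ∷ w) i =
    trans (cong (prod (conjugate π w) ⟨$⟩ʳ_) (transpose-conjugate π (proj₁ p) (proj₂ p) i))
          (prod-conjugate π w _)

  prod-++-comm : (u v : Factorisation n) → prod (u ++ v) ≈ prod (v ++ conjugate (prod v) u)
  prod-++-comm u v i = begin
    prod (u ++ v) ⟨$⟩ʳ i                              ≡⟨ prod-++ u v i ⟩
    prod v ⟨$⟩ʳ (prod u ⟨$⟩ʳ i)                       ≡⟨ sym (prod-conjugate (prod v) u i) ⟩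
    prod (conjugate (prod v) u) ⟨$⟩ʳ (prod v ⟨$⟩ʳ i)  ≡⟨ sym (prod-++ v _ i) ⟩
    prod (v ++ conjugate (prod v) u) ⟨$⟩ʳ i           ∎

  prod-++-transpose : (w : Factorisation n) (x y : Fin n) →
                      prod (w ++ (x , y) ∷ []) ≈ prod ((y , x) ∷ conjugate (transpose x y) w)
  prod-++-transpose w x y i =
    trans (prod-++-comm w ((x , y) ∷ []) i)
          (cong (prod (conjugate (transpose x y) w) ⟨$⟩ʳ_) (transpose-comm x y i))

  conjugate-inverse : (π π′ : Permutation′ n) → (∀ x → π′ ⟨$⟩ʳ (π ⟨$⟩ʳ x) ≡ x) →
                      (w : Factorisation n) → conjugate π′ (conjugate π w) ≡ w
  conjugate-inverse π π′ inv []      = refl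
  conjugate-inverse π π′ inv (p ∷ w) =
    cong₂ _∷_ (cong₂ _,_ (inv (proj₁ p)) (inv (proj₂ p))) (conjugate-inverse π π′ inv w)

  All-conjugate : ∀ {ℓ ℓ′} {Q : Pred (Fin n) ℓ} {Q′ : Pred (Fin n) ℓ′} (π : Permutation′ n)
                  {c c′ w} → (∀ {x} → Q x → Q′ (π ⟨$⟩ʳ x)) → π ⟨$⟩ʳ c ≡ c′ →
                  All (Q ▹ c) w → All (Q′ ▹ c′) (conjugate π w)
  All-conjugate π Q⇒Q′ πc≡c′ =
    map⁺ ∘ All.map (λ (q , e) → Q⇒Q′ q , trans (cong (π ⟨$⟩ʳ_) e) πc≡c′)

  module _ {ℓ} (Q : Pred (Fin n) ℓ) where

    prod-preserves : {w : Factorisation n} → All (λ p → Q (proj₁ p) × Q (proj₂ p)) w →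
                     ∀ {i} → Q i → Q (prod w ⟨$⟩ʳ i)
    prod-preserves []               qi = qi
    prod-preserves ((qx , qy) ∷ qs) qi = prod-preserves qs (transpose-preserves Q qx qy qi)

    prod⁻¹-preserves : {w : Factorisation n} → All (λ p → Q (proj₁ p) × Q (proj₂ p)) w →
                       ∀ {i} → Q i → Q (prod w ⟨$⟩ˡ i)
    prod⁻¹-preserves []               qi = qi
    prod⁻¹-preserves ((qx , qy) ∷ qs) qi = transpose-preserves Q qy qx (prod⁻¹-preserves qs qi)

  prod-fix : {a : Fin n} {w : Factorisation n} → All (λ p → a ≢ proj₁ p × a ≢ proj₂ p) w →
             prod w ⟨$⟩ʳ a ≡ a
  prod-fix                 []                   = refl
  prod-fix {w = _ ∷ w} ((a≢x , a≢y) ∷ ps) =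
    trans (cong (prod w ⟨$⟩ʳ_) (transpose-fix a≢x a≢y)) (prod-fix ps)

module _ {A : Set} (_≟ᴬ_ : DecidableEquality A) (x : A) where

  splitFirst : List A → Maybe (List A × List A)
  splitFirst []       = nothing
  splitFirst (y ∷ ys) with y ≟ᴬ x
  ... | yes _ = just ([] , ys)
  ... | no  _ = Maybe.map (map₁ (y ∷_)) (splitFirst ys)

  splitLast : List A → Maybe (List A × List A)
  splitLast []       = nothing
  splitLast (y ∷ ys) with splitLast ys | y ≟ᴬ x
  ... | just (l , r) | _     = just (y ∷ l , r)
  ... | nothing      | yes _ = just ([] , ys)
  ... | nothing      | no  _ = nothing

  data FirstSplit (ys : List A) : Maybe (List A × List A) → Set where
    absent  : All (_≢ x) ys → FirstSplit ys nothing
    present : ∀ {l r} → ys ≡ l ++ x ∷ r → All (_≢ x) l → FirstSplit ys (just (l , r))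

  data LastSplit (ys : List A) : Maybe (List A × List A) → Set where
    absent  : All (_≢ x) ys → LastSplit ys nothing
    present : ∀ {l r} → ys ≡ l ++ x ∷ r → All (_≢ x) r → LastSplit ys (just (l , r))

  splitFirst-view : ∀ ys → FirstSplit ys (splitFirst ys)
  splitFirst-view []       = absent []
  splitFirst-view (y ∷ ys) with y ≟ᴬ x
  ... | yes refl = present refl []
  ... | no  y≢x with splitFirst ys | splitFirst-view ys
  ...   | nothing | absent  x∉ys      = absent (y≢x ∷ x∉ys)
  ...   | just _  | present refl x∉l  = present refl (y≢x ∷ x∉l)

  splitLast-view : ∀ ys → LastSplit ys (splitLast ys)
  splitLast-view []       = absent []
  splitLast-view (y ∷ ys) with splitLast ys | splitLast-view ys | y ≟ᴬ x
  ... | just _  | present refl x∉r | _       = present refl x∉r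
  ... | nothing | absent x∉ys      | yes refl = present refl x∉ys
  ... | nothing | absent x∉ys      | no  y≢x  = absent (y≢x ∷ x∉ys)

  splitFirst-absent : ∀ {ys} → All (_≢ x) ys → splitFirst ys ≡ nothing
  splitFirst-absent              []          = refl
  splitFirst-absent {y ∷ _} (y≢x ∷ x∉ys) with y ≟ᴬ x
  ... | yes y≡x = contradiction y≡x y≢x
  ... | no  _   = cong (Maybe.map _) (splitFirst-absent x∉ys)

  splitFirst-present : ∀ {l r} → All (_≢ x) l → splitFirst (l ++ x ∷ r) ≡ just (l , r)
  splitFirst-present {[]} [] with x ≟ᴬ x
  ... | yes _   = refl
  ... | no  x≢x = contradiction refl x≢x
  splitFirst-present {y ∷ _} (y≢x ∷ x∉l) with y ≟ᴬ x
  ... | yes y≡x = contradiction y≡x y≢x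
  ... | no  _   = cong (Maybe.map _) (splitFirst-present x∉l)

  splitLast-absent : ∀ {ys} → All (_≢ x) ys → splitLast ys ≡ nothing
  splitLast-absent              []          = refl
  splitLast-absent {y ∷ _} (y≢x ∷ x∉ys) rewrite splitLast-absent x∉ys with y ≟ᴬ x
  ... | yes y≡x = contradiction y≡x y≢x
  ... | no  _   = refl

  splitLast-present : ∀ {l r} → All (_≢ x) r → splitLast (l ++ x ∷ r) ≡ just (l , r)
  splitLast-present {[]}    x∉r rewrite splitLast-absent x∉r with x ≟ᴬ x
  ... | yes _   = refl
  ... | no  x≢x = contradiction refl x≢x
  splitLast-present {_ ∷ l} x∉r rewrite splitLast-present {l} x∉r = refl

module _ {A : Set} where

  Linked-++⁻ : ∀ {ℓ} {R : Rel A ℓ} xs {ys} → Linked R (xs ++ ys) → Linked R xs × Linked R ys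
  Linked-++⁻ []           l       = [] , l
  Linked-++⁻ (x ∷ [])     l       = [-] , Linked.tail l
  Linked-++⁻ (x ∷ y ∷ xs) (r ∷ l) = map₁ (r ∷_) (Linked-++⁻ (y ∷ xs) l)

  Sorted : (A → ℕ) → List A → Set
  Sorted κ = Linked (_≤_ on κ)

  sorted-cong : {κ κ′ : A → ℕ} {xs : List A} → All (λ x → κ′ x ≡ κ x) xs →
                Sorted κ xs → Sorted κ′ xs
  sorted-cong []            []      = []
  sorted-cong (_ ∷ [])      [-]     = [-]
  sorted-cong (e ∷ e′ ∷ es) (r ∷ l) = subst₂ _≤_ (sym e) (sym e′) r ∷ sorted-cong (e′ ∷ es) l

  module _ (κ : A → ℕ) where

    cut : ℕ → List A → List A × List A
    cut t xs = takeWhile (λ x → κ x <? t) xs , dropWhile (λ x → κ x <? t) xs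

    uncut-cut : ∀ t xs → uncurry _++_ (cut t xs) ≡ xs
    uncut-cut t = takeWhile++dropWhile (λ x → κ x <? t)

    cut-uncut : ∀ {t ys zs} → All (λ x → κ x < t) ys → All (λ x → t ≤ κ x) zs →
                cut t (ys ++ zs) ≡ (ys , zs)
    cut-uncut                   []            []          = refl
    cut-uncut {t} {zs = z ∷ _}  []            (t≤κz ∷ _)
      rewrite dec-false (κ z <? t) (≤⇒≯ t≤κz) = refl
    cut-uncut {t} {y ∷ _}       (κy<t ∷ ys<t) zs≥t
      rewrite dec-true (κ y <? t) κy<t = cong (map₁ (y ∷_)) (cut-uncut ys<t zs≥t)

    cut-below : ∀ t xs → All (λ x → κ x < t) (proj₁ (cut t xs))
    cut-below t = all-takeWhile (λ x → κ x <? t)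

    cut-above : ∀ {t xs} → Sorted κ xs → All (λ x → t ≤ κ x) (proj₂ (cut t xs))
    cut-above              []     = []
    cut-above {t} {x ∷ xs} sorted with κ x <? t
    ... | yes κx<t rewrite dec-true (κ x <? t) κx<t = cut-above {t} {xs} (Linked.tail sorted)
    ... | no κx≮t rewrite dec-false (κ x <? t) κx≮t =
      All.map (≤-trans (≮⇒≥ κx≮t)) (Linked⇒All ≤-trans {v = x} ≤-refl sorted)

    sorted-cut : ∀ t {xs} → Sorted κ xs →
                 Sorted κ (proj₁ (cut t xs)) × Sorted κ (proj₂ (cut t xs))
    sorted-cut t {xs} sorted = Linked-++⁻ _ (subst (Sorted κ) (sym (uncut-cut t xs)) sorted)

    sorted-++ : ∀ {t ys zs} → Sorted κ ys → Sorted κ zs →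
                All (λ x → κ x < t) ys → All (λ x → t ≤ κ x) zs → Sorted κ (ys ++ zs)
    sorted-++ []      szs _                 _          = szs
    sorted-++ [-]     []  _                 _          = [-]
    sorted-++ [-]     szs (κy<t ∷ [])       (t≤κz ∷ _) = ≤-trans (<⇒≤ κy<t) t≤κz ∷ szs
    sorted-++ (r ∷ l) szs (_ ∷ ys<t)        zs≥t       = r ∷ sorted-++ l szs ys<t zs≥t

    sorted-constant : ∀ {t xs} → All (λ x → κ x ≡ t) xs → Sorted κ xs
    sorted-constant []            = []
    sorted-constant (_ ∷ [])      = [-]
    sorted-constant (e ∷ e′ ∷ es) = ≤-reflexive (trans e (sym e′)) ∷ sorted-constant (e′ ∷ es)

-- The middle block

Middle : ℕ → Set
Middle n = Factorisation n × Factorisation n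

word : ∀ {n} → Middle n → Factorisation n
word m = proj₁ m ++ proj₂ m

ValidMiddle : ∀ {n} → (Fin n → Set) → Fin n → Fin n → Middle n → Set
ValidMiddle L a b m = All (L ▹ a) (proj₁ m) × All ((L ∪ ｛ a ｝) ▹ b) (proj₂ m)

ValidMiddle-mono : ∀ {n} {L L′ : Fin n → Set} {a b m} → (∀ {x} → L x → L′ x) →
                   ValidMiddle L a b m → ValidMiddle L′ a b m
ValidMiddle-mono L⇒L′ (U-ok , V-ok) =
  All.map (map₁ L⇒L′) U-ok , All.map (map₁ (Sum.map₁ L⇒L′)) V-ok

module MiddleBijection {n} (L : Fin n → Set) (a b : Fin n)
                       (a≢b : a ≢ b) (a∉L : ¬ L a) (b∉L : ¬ L b) where
  open ≡-Reasoning

  _≟²_ : DecidableEquality (Fin n × Fin n)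
  _≟²_ = ≡-dec _≟_ _≟_

  Absorbed : Middle n → Set
  Absorbed m = All ((L ∪ ｛ b ｝) ▹ a) (proj₁ m) × All (L ▹ b) (proj₂ m)

  absorb : Middle n → Middle n
  absorb (X , Y) with splitLast _≟²_ (a , b) Y
  ... | nothing       = X , Y
  ... | just (Y₁ , H) = X ++ (b , a) ∷ conjugate (transpose a b) Y₁ , H

  unabsorb : Middle n → Middle n
  unabsorb (Z , H) with splitFirst _≟²_ (b , a) Z
  ... | nothing       = Z , H
  ... | just (X , Z₂) = X , conjugate (transpose b a) Z₂ ++ (a , b) ∷ H

  commute : Middle n → Middle n
  commute (Z , H) = H , conjugate (prod H) Z

  uncommute : Middle n → Middle n
  uncommute (H , Z) = conjugate (flip (prod H)) Z , H

  to : Middle n → Middle n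
  to = commute ∘ absorb

  from : Middle n → Middle n
  from = unabsorb ∘ uncommute

  ▹-weaken : ∀ {c d p} → (L ▹ d) p → ((L ∪ ｛ c ｝) ▹ d) p
  ▹-weaken (l , e) = inj₁ l , e

  ▹-strengthen : ∀ {c d p} → ((L ∪ ｛ c ｝) ▹ d) p → p ≢ (c , d) → (L ▹ d) p
  ▹-strengthen (inj₁ l    , e)    _     = l , e
  ▹-strengthen (inj₂ refl , refl) p≢cd = contradiction refl p≢cd

  ▹-≢ : ∀ {c d e p} → ¬ L c → (L ▹ d) p → p ≢ (c , e)
  ▹-≢ c∉L (l , _) refl = c∉L l

  transpose-∪ : ∀ {c d} → ¬ L c → ¬ L d → ∀ {x} →
                (L ∪ ｛ c ｝) x → (L ∪ ｛ d ｝) (transpose c d ⟨$⟩ʳ x)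
  transpose-∪ c∉L d∉L (inj₁ l) =
    inj₁ (subst L (sym (transpose-fix (λ { refl → c∉L l }) (λ { refl → d∉L l }))) l)
  transpose-∪ {c} {d} _ _ (inj₂ refl) = inj₂ (sym (transpose-matchˡ c d))

  prod-fixes-a : ∀ {H} → All (L ▹ b) H → prod H ⟨$⟩ʳ a ≡ a
  prod-fixes-a = prod-fix ∘ All.map (λ (l , e) → (λ { refl → a∉L l }) , λ a≡y → a≢b (trans a≡y e))

  prod⁻¹-fixes-a : ∀ {H} → All (L ▹ b) H → prod H ⟨$⟩ˡ a ≡ a
  prod⁻¹-fixes-a {H} H-ok =
    trans (cong (prod H ⟨$⟩ˡ_) (sym (prod-fixes-a H-ok))) (inverseˡ (prod H))

  L∪b-closed : ∀ {H} → All (L ▹ b) H →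
               All (λ p → (L ∪ ｛ b ｝) (proj₁ p) × (L ∪ ｛ b ｝) (proj₂ p)) H
  L∪b-closed = All.map (λ (l , e) → inj₁ l , inj₂ (sym e))

  absorb-valid : ∀ {m} → ValidMiddle L a b m → Absorbed (absorb m)
  absorb-valid {X , Y} (X-ok , Y-ok)
    with splitLast _≟²_ (a , b) Y | splitLast-view _≟²_ (a , b) Y
  ... | nothing       | absent Y∌ab       =
    All.map ▹-weaken X-ok , All.zipWith (uncurry ▹-strengthen) (Y-ok , Y∌ab)
  ... | just (Y₁ , H) | present refl H∌ab =
    ++⁺ (All.map ▹-weaken X-ok)
        ((inj₂ refl , refl) ∷
         All-conjugate (transpose a b) (transpose-∪ a∉L b∉L) (transpose-matchʳ a b)
                       (++⁻ˡ Y₁ Y-ok)) ,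
    All.zipWith (uncurry ▹-strengthen) (All.tail (++⁻ʳ Y₁ Y-ok) , H∌ab)

  unabsorb-valid : ∀ {m} → Absorbed m → ValidMiddle L a b (unabsorb m)
  unabsorb-valid {Z , H} (Z-ok , H-ok)
    with splitFirst _≟²_ (b , a) Z | splitFirst-view _≟²_ (b , a) Z
  ... | nothing       | absent Z∌ba       =
    All.zipWith (uncurry ▹-strengthen) (Z-ok , Z∌ba) , All.map ▹-weaken H-ok
  ... | just (X , Z₂) | present refl X∌ba =
    All.zipWith (uncurry ▹-strengthen) (++⁻ˡ X Z-ok , X∌ba) ,
    ++⁺ (All-conjugate (transpose b a) (transpose-∪ b∉L a∉L) (transpose-matchʳ b a)
                       (All.tail (++⁻ʳ X Z-ok)))
        ((inj₂ refl , refl) ∷ All.map ▹-weaken H-ok)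

  commute-valid : ∀ {m} → Absorbed m → ValidMiddle L b a (commute m)
  commute-valid {Z , H} (Z-ok , H-ok) =
    H-ok ,
    All-conjugate (prod H) (prod-preserves (L ∪ ｛ b ｝) (L∪b-closed H-ok)) (prod-fixes-a H-ok) Z-ok

  uncommute-valid : ∀ {m} → ValidMiddle L b a m → Absorbed (uncommute m)
  uncommute-valid {H , Z} (H-ok , Z-ok) =
    All-conjugate (flip (prod H)) (prod⁻¹-preserves (L ∪ ｛ b ｝) (L∪b-closed H-ok))
                  (prod⁻¹-fixes-a H-ok) Z-ok ,
    H-ok

  unabsorb-absorb : ∀ {m} → All (L ▹ a) (proj₁ m) → unabsorb (absorb m) ≡ m
  unabsorb-absorb {X , Y} X-ok with splitLast _≟²_ (a , b) Y | splitLast-view _≟²_ (a , b) Y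
  ... | nothing       | absent _
    rewrite splitFirst-absent _≟²_ (b , a) (All.map (▹-≢ b∉L) X-ok) = refl
  ... | just (Y₁ , H) | present refl _
    rewrite splitFirst-present _≟²_ (b , a) {r = conjugate (transpose a b) Y₁}
                               (All.map (▹-≢ b∉L) X-ok) =
    cong (λ Y₁′ → X , Y₁′ ++ (a , b) ∷ H)
         (conjugate-inverse (transpose a b) (transpose b a) (λ _ → transpose-inverse b a) Y₁)

  absorb-unabsorb : ∀ {m} → All (L ▹ b) (proj₂ m) → absorb (unabsorb m) ≡ m
  absorb-unabsorb {Z , H} H-ok with splitFirst _≟²_ (b , a) Z | splitFirst-view _≟²_ (b , a) Z
  ... | nothing       | absent _
    rewrite splitLast-absent _≟²_ (a , b) (All.map (▹-≢ a∉L) H-ok) = refl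
  ... | just (X , Z₂) | present refl _
    rewrite splitLast-present _≟²_ (a , b) {l = conjugate (transpose b a) Z₂}
                              (All.map (▹-≢ a∉L) H-ok) =
    cong (λ Z₂′ → X ++ (b , a) ∷ Z₂′ , H)
         (conjugate-inverse (transpose b a) (transpose a b) (λ _ → transpose-inverse a b) Z₂)

  uncommute-commute : ∀ m → uncommute (commute m) ≡ m
  uncommute-commute (Z , H) =
    cong (_, H) (conjugate-inverse (prod H) (flip (prod H)) (λ _ → inverseˡ (prod H)) Z)

  commute-uncommute : ∀ m → commute (uncommute m) ≡ m
  commute-uncommute (H , Z) =
    cong (H ,_) (conjugate-inverse (flip (prod H)) (prod H) (λ _ → inverseʳ (prod H)) Z)

  absorb-prod : ∀ m → prod (word (absorb m)) ≈ prod (word m)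
  absorb-prod (X , Y) i with splitLast _≟²_ (a , b) Y | splitLast-view _≟²_ (a , b) Y
  ... | nothing       | absent _       = refl
  ... | just (Y₁ , H) | present refl _ = begin
    prod ((X ++ (b , a) ∷ C) ++ H) ⟨$⟩ʳ i
      ≡⟨ cong (λ w → prod w ⟨$⟩ʳ i) (++-assoc X ((b , a) ∷ C) H) ⟩
    prod (X ++ ((b , a) ∷ C) ++ H) ⟨$⟩ʳ i
      ≡⟨ prod-cong-middle X H (λ j → sym (prod-++-transpose Y₁ a b j)) i ⟩
    prod (X ++ (Y₁ ++ (a , b) ∷ []) ++ H) ⟨$⟩ʳ i
      ≡⟨ cong (λ w → prod (X ++ w) ⟨$⟩ʳ i) (++-assoc Y₁ ((a , b) ∷ []) H) ⟩
    prod (X ++ Y₁ ++ (a , b) ∷ H) ⟨$⟩ʳ i ∎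
    where C = conjugate (transpose a b) Y₁

  absorb-length : ∀ m → length (word (absorb m)) ≡ length (word m)
  absorb-length (X , Y) with splitLast _≟²_ (a , b) Y | splitLast-view _≟²_ (a , b) Y
  ... | nothing       | absent _       = refl
  ... | just (Y₁ , H) | present refl _ = begin
    length ((X ++ (b , a) ∷ C) ++ H)        ≡⟨ cong length (++-assoc X ((b , a) ∷ C) H) ⟩
    length (X ++ ((b , a) ∷ C) ++ H)        ≡⟨ length-cong-middle X H |ba∷C|≡|Y₁∷ab| ⟩
    length (X ++ (Y₁ ++ (a , b) ∷ []) ++ H) ≡⟨ cong (λ w → length (X ++ w)) (++-assoc Y₁ _ H) ⟩
    length (X ++ Y₁ ++ (a , b) ∷ H)         ∎
    where
    C = conjugate (transpose a b) Y₁
    |ba∷C|≡|Y₁∷ab| : length ((b , a) ∷ C) ≡ length (Y₁ ++ (a , b) ∷ [])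
    |ba∷C|≡|Y₁∷ab| = trans (cong suc (length-map _ Y₁)) (length-++-comm ((a , b) ∷ []) Y₁)

  commute-prod : ∀ m → prod (word (commute m)) ≈ prod (word m)
  commute-prod (Z , H) i = sym (prod-++-comm Z H i)

  commute-length : ∀ m → length (word (commute m)) ≡ length (word m)
  commute-length (Z , H) =
    trans (length-++-comm H _) (length-cong-middle [] {conjugate (prod H) Z} {Z} H (length-map _ Z))

  to-valid : ∀ {m} → ValidMiddle L a b m → ValidMiddle L b a (to m)
  to-valid = commute-valid ∘ absorb-valid

  from-valid : ∀ {m} → ValidMiddle L b a m → ValidMiddle L a b (from m)
  from-valid = unabsorb-valid ∘ uncommute-valid

  from-to : ∀ {m} → ValidMiddle L a b m → from (to m) ≡ m
  from-to {m} (X-ok , _) =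
    trans (cong unabsorb (uncommute-commute (absorb m))) (unabsorb-absorb X-ok)

  to-from : ∀ {m} → ValidMiddle L b a m → to (from m) ≡ m
  to-from {m} (H-ok , _) =
    trans (cong commute (absorb-unabsorb H-ok)) (commute-uncommute m)

  to-prod : ∀ m → prod (word (to m)) ≈ prod (word m)
  to-prod m i = trans (commute-prod (absorb m) i) (absorb-prod m i)

  to-length : ∀ m → length (word (to m)) ≡ length (word m)
  to-length m = trans (commute-length (absorb m)) (absorb-length m)

  from-prod : ∀ {m} → ValidMiddle L b a m → prod (word (from m)) ≈ prod (word m)
  from-prod {m} v i =
    trans (sym (to-prod (from m) i)) (cong (λ m′ → prod (word m′) ⟨$⟩ʳ i) (to-from v))

  from-length : ∀ {m} → ValidMiddle L b a m → length (word (from m)) ≡ length (word m)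
  from-length {m} v =
    trans (sym (to-length (from m))) (cong (length ∘ word) (to-from v))

-- The blocks of a monotone factorisation

Below : ∀ {n} → Order n → ℕ → Fin n → Set
Below s J x = rank s x < J

rank-injective : ∀ {n} (s : Order n) {x y : Fin n} → rank s x ≡ rank s y → x ≡ y
rank-injective s = Injection.injective (↔⇒↣ (flip s)) ∘ toℕ-injective

record Parts (n : ℕ) : Set where
  constructor parts
  field
    low    : Factorisation n
    middle : Middle n
    high   : Factorisation n

assemble : ∀ {n} → Parts n → Factorisation n
assemble (parts P m S) = P ++ word m ++ S

mapMiddle : ∀ {n} → (Middle n → Middle n) → Parts n → Parts n
mapMiddle μ (parts P m S) = parts P (μ m) S

module Blocks {n} (s : Order n) (J : ℕ) (c₁ c₂ : Fin n) where

  key : Fin n × Fin n → ℕ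
  key p = rank s (proj₂ p)

  Ordered : Factorisation n → Set
  Ordered = All (λ p → proj₁ p ≺[ s ] proj₂ p)

  Segment : (ℕ → Set) → Factorisation n → Set
  Segment B w = All (B ∘ key) w × Ordered w × Sorted key w

  record ValidParts (p : Parts n) : Set where
    constructor valid-parts
    field
      low-valid    : Segment (_< J) (Parts.low p)
      middle-valid : ValidMiddle (Below s J) c₁ c₂ (Parts.middle p)
      high-valid   : Segment (suc (suc J) ≤_) (Parts.high p)

  splitMiddle : Factorisation n → Factorisation n × Factorisation n → Parts n
  splitMiddle P (M , S) = parts P (cut key (suc J) M) S

  split : Factorisation n → Parts n
  split f = let (P , R) = cut key J f in splitMiddle P (cut key (suc (suc J)) R)

  assemble-split : ∀ f → assemble (split f) ≡ f
  assemble-split f =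
    let (P , R) = cut key J f
        (M , S) = cut key (suc (suc J)) R
    in trans (cong (P ++_) (trans (cong (_++ S) (uncut-cut key (suc J) M)) (uncut-cut key _ R)))
             (uncut-cut key J f)

  module _ (rank-c₁ : rank s c₁ ≡ J) (rank-c₂ : rank s c₂ ≡ suc J) where

    first-block⁻ : ∀ {p} → (Below s J ▹ c₁) p → key p ≡ J × proj₁ p ≺[ s ] proj₂ p
    first-block⁻ {p} (below , refl) =
      rank-c₁ , subst (rank s (proj₁ p) <_) (sym rank-c₁) below

    second-block⁻ : ∀ {p} → ((Below s J ∪ ｛ c₁ ｝) ▹ c₂) p → key p ≡ suc J × proj₁ p ≺[ s ] proj₂ p
    second-block⁻ {p} (x-ok , refl) =
      rank-c₂ , subst (rank s (proj₁ p) <_) (sym rank-c₂) (below-suc x-ok)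
      where
      below-suc : (Below s J ∪ ｛ c₁ ｝) (proj₁ p) → rank s (proj₁ p) < suc J
      below-suc (inj₁ below) = m<n⇒m<1+n below
      below-suc (inj₂ refl)  = ≤-reflexive (cong suc rank-c₁)

    first-block⁺ : ∀ {p} → key p ≡ J → proj₁ p ≺[ s ] proj₂ p → (Below s J ▹ c₁) p
    first-block⁺ {p} key≡J ordered =
      subst (rank s (proj₁ p) <_) key≡J ordered , rank-injective s (trans key≡J (sym rank-c₁))

    second-block⁺ : ∀ {p} → key p ≡ suc J → proj₁ p ≺[ s ] proj₂ p → ((Below s J ∪ ｛ c₁ ｝) ▹ c₂) p
    second-block⁺ {p} key≡1+J ordered
      with m<1+n⇒m<n∨m≡n (subst (rank s (proj₁ p) <_) key≡1+J ordered)
    ... | inj₁ below   = inj₁ below , rank-injective s (trans key≡1+J (sym rank-c₂))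
    ... | inj₂ rank≡J = inj₂ (rank-injective s (trans rank-c₁ (sym rank≡J))) ,
                         rank-injective s (trans key≡1+J (sym rank-c₂))

    middle-bands : ∀ {U V} → ValidMiddle (Below s J) c₁ c₂ (U , V) →
                   All (λ p → key p < suc J) U × All (λ p → suc J ≤ key p) V ×
                   All (λ p → key p < suc (suc J)) (U ++ V) × All (λ p → J ≤ key p) (U ++ V)
    middle-bands (U-ok , V-ok) =
      U-below , V-above ,
      ++⁺ (All.map m<n⇒m<1+n U-below) (All.map (λ v → ≤-reflexive (cong suc (key-V v))) V-ok) ,
      ++⁺ (All.map (λ u → ≤-reflexive (sym (key-U u))) U-ok) (All.map (≤-trans (n≤1+n J)) V-above)
      where
      key-U : ∀ {p} → (Below s J ▹ c₁) p → key p ≡ J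
      key-U = proj₁ ∘ first-block⁻
      key-V : ∀ {p} → ((Below s J ∪ ｛ c₁ ｝) ▹ c₂) p → key p ≡ suc J
      key-V = proj₁ ∘ second-block⁻
      U-below = All.map (λ u → ≤-reflexive (cong suc (key-U u))) U-ok
      V-above = All.map (λ v → ≤-reflexive (sym (key-V v))) V-ok

    split-valid : ∀ {f} → Ordered f → Sorted key f → ValidParts (split f)
    split-valid {f} ordered sorted = valid-parts
      (cut-below key J f , takeWhile⁺ _ ordered , proj₁ (sorted-cut key J sorted))
      (All.zipWith (uncurry first-block⁺) (U-keys , takeWhile⁺ _ M-ordered) ,
       All.zipWith (uncurry second-block⁺) (V-keys , dropWhile⁺ _ M-ordered))
      (cut-above key R-sorted , dropWhile⁺ _ R-ordered , proj₂ (sorted-cut key _ R-sorted))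
      where
      R = proj₂ (cut key J f)
      M = proj₁ (cut key (suc (suc J)) R)
      R-sorted = proj₂ (sorted-cut key J sorted)
      M-sorted = proj₁ (sorted-cut key (suc (suc J)) R-sorted)
      R-ordered = dropWhile⁺ _ ordered
      M-ordered = takeWhile⁺ _ R-ordered
      squeeze : ∀ {m t} → m < suc t → t ≤ m → m ≡ t
      squeeze m<1+t t≤m = ≤-antisym (s≤s⁻¹ m<1+t) t≤m
      U-keys : All (λ p → key p ≡ J) (proj₁ (cut key (suc J) M))
      U-keys = All.zipWith (uncurry squeeze)
                 (cut-below key (suc J) M , takeWhile⁺ _ (takeWhile⁺ _ (cut-above key sorted)))
      V-keys : All (λ p → key p ≡ suc J) (proj₂ (cut key (suc J) M))
      V-keys = All.zipWith (uncurry squeeze)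
                 (dropWhile⁺ _ (cut-below key _ R) , cut-above key M-sorted)

    split-assemble : ∀ {p} → ValidParts p → split (assemble p) ≡ p
    split-assemble {parts P (U , V) S} (valid-parts (P-below , _) middle-ok (S-above , _))
      with middle-bands middle-ok
    ... | U-below , V-above , UV-below , UV-above = begin
      split (P ++ (U ++ V) ++ S)
        ≡⟨ cong (λ c → splitMiddle (proj₁ c) (cut key (suc (suc J)) (proj₂ c)))
                (cut-uncut key P-below (++⁺ UV-above (All.map (≤-trans (m≤n+m J 2)) S-above))) ⟩
      splitMiddle P (cut key (suc (suc J)) ((U ++ V) ++ S))
        ≡⟨ cong (splitMiddle P) (cut-uncut key UV-below S-above) ⟩
      parts P (cut key (suc J) (U ++ V)) S
        ≡⟨ cong (λ m → parts P m S) (cut-uncut key U-below V-above) ⟩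
      parts P (U , V) S ∎
      where open ≡-Reasoning

    assemble-valid : ∀ {p} → ValidParts p → Ordered (assemble p) × Sorted key (assemble p)
    assemble-valid {parts P (U , V) S} (valid-parts (P-below , P-ordered , P-sorted) (U-ok , V-ok)
                                                    (S-above , S-ordered , S-sorted))
      with middle-bands (U-ok , V-ok)
    ... | U-below , V-above , UV-below , UV-above =
      ++⁺ P-ordered (++⁺ (++⁺ (All.map (proj₂ ∘ first-block⁻) U-ok)
                              (All.map (proj₂ ∘ second-block⁻) V-ok))
                         S-ordered) ,
      sorted-++ key P-sorted (sorted-++ key UV-sorted S-sorted UV-below S-above) P-below
                (++⁺ UV-above (All.map (≤-trans (m≤n+m J 2)) S-above))
      where
      UV-sorted = sorted-++ key (sorted-constant key (All.map (proj₁ ∘ first-block⁻) U-ok))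
                                (sorted-constant key (All.map (proj₁ ∘ second-block⁻) V-ok))
                                U-below V-above

-- Adjacent orders

record AdjacentOrders {n} (s s′ : Order n) (J : ℕ) (c₁ c₂ : Fin n) : Set where
  field
    rank-c₁     : rank s c₁ ≡ J
    rank-c₂     : rank s c₂ ≡ suc J
    rank′-c₁    : rank s′ c₁ ≡ suc J
    rank′-c₂    : rank s′ c₂ ≡ J
    rank′-other : ∀ {x} → x ≢ c₁ → x ≢ c₂ → rank s′ x ≡ rank s x

adjacent-sym : ∀ {n} {s s′ : Order n} {J c₁ c₂} →
               AdjacentOrders s s′ J c₁ c₂ → AdjacentOrders s′ s J c₂ c₁
adjacent-sym A = record
  { rank-c₁     = rank′-c₂
  ; rank-c₂     = rank′-c₁
  ; rank′-c₁    = rank-c₂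
  ; rank′-c₂    = rank-c₁
  ; rank′-other = λ x≢c₂ x≢c₁ → sym (rank′-other x≢c₁ x≢c₂)
  }
  where open AdjacentOrders A

swapOrder-adjacent : ∀ {n} (s : Order n) (j k : Fin n) → toℕ k ≡ suc (toℕ j) →
                     AdjacentOrders s (swapOrder s j k) (toℕ j) (s ⟨$⟩ʳ j) (s ⟨$⟩ʳ k)
swapOrder-adjacent s j k k≡1+j = record
  { rank-c₁     = cong toℕ (inverseˡ s)
  ; rank-c₂     = trans (cong toℕ (inverseˡ s)) k≡1+j
  ; rank′-c₁    = trans (cong (toℕ ∘ (transpose k j ⟨$⟩ʳ_)) (inverseˡ s))
                        (trans (cong toℕ (transpose-matchʳ k j)) k≡1+j)
  ; rank′-c₂    = trans (cong (toℕ ∘ (transpose k j ⟨$⟩ʳ_)) (inverseˡ s))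
                        (cong toℕ (transpose-matchˡ k j))
  ; rank′-other = λ x≢sj x≢sk →
      cong toℕ (transpose-fix (x≢sk ∘ position⇒element) (x≢sj ∘ position⇒element))
  }
  where
  position⇒element : ∀ {x i} → s ⟨$⟩ˡ x ≡ i → x ≡ s ⟨$⟩ʳ i
  position⇒element refl = sym (inverseʳ s)

record MiddleMap {n} (s s′ : Order n) (J : ℕ) (c₁ c₂ : Fin n) : Set where
  field
    apply            : Middle n → Middle n
    valid            : ∀ {m} → ValidMiddle (Below s J) c₁ c₂ m →
                       ValidMiddle (Below s′ J) c₂ c₁ (apply m)
    preserves-prod   : ∀ {m} → ValidMiddle (Below s J) c₁ c₂ m →
                       prod (word (apply m)) ≈ prod (word m)
    preserves-length : ∀ {m} → ValidMiddle (Below s J) c₁ c₂ m →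
                       length (word (apply m)) ≡ length (word m)

transport : ∀ {n} {s s′ : Order n} {J c₁ c₂} → MiddleMap s s′ J c₁ c₂ →
            Factorisation n → Factorisation n
transport {s = s} {J = J} {c₁} {c₂} μ =
  assemble ∘ mapMiddle (MiddleMap.apply μ) ∘ Blocks.split s J c₁ c₂

module Adjacent {n} {s s′ : Order n} {J : ℕ} {c₁ c₂ : Fin n}
                (A : AdjacentOrders s s′ J c₁ c₂) where
  open AdjacentOrders A

  module S  = Blocks s  J c₁ c₂
  module S′ = Blocks s′ J c₂ c₁

  rank≢J⇒≢c₁ : ∀ {x} → rank s x ≢ J → x ≢ c₁
  rank≢J⇒≢c₁ rank≢J refl = rank≢J rank-c₁

  rank≢1+J⇒≢c₂ : ∀ {x} → rank s x ≢ suc J → x ≢ c₂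
  rank≢1+J⇒≢c₂ rank≢1+J refl = rank≢1+J rank-c₂

  rank-low : ∀ {x} → rank s x < J → rank s′ x ≡ rank s x
  rank-low lt = rank′-other (rank≢J⇒≢c₁ (<⇒≢ lt)) (rank≢1+J⇒≢c₂ (<⇒≢ (m<n⇒m<1+n lt)))

  rank-high : ∀ {x} → suc (suc J) ≤ rank s x → rank s′ x ≡ rank s x
  rank-high le =
    rank′-other (rank≢J⇒≢c₁ (>⇒≢ (≤-trans (n≤1+n (suc J)) le))) (rank≢1+J⇒≢c₂ (>⇒≢ le))

  below-transfer : ∀ {x} → Below s J x → Below s′ J x
  below-transfer lt = subst (_< J) (sym (rank-low lt)) lt

  ≺-high : ∀ {x y} → suc (suc J) ≤ rank s y → x ≺[ s ] y → x ≺[ s′ ] y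
  ≺-high {x} {y} le x≺y rewrite rank-high le with x ≟ c₁ | x ≟ c₂
  ... | yes refl | _        = subst (_< rank s y) (sym rank′-c₁) le
  ... | no _     | yes refl = subst (_< rank s y) (sym rank′-c₂) (≤-trans (n≤1+n (suc J)) le)
  ... | no x≢c₁  | no x≢c₂  = subst (_< rank s y) (sym (rank′-other x≢c₁ x≢c₂)) x≺y

  low-transfer : ∀ {P} → S.Segment (_< J) P → S′.Segment (_< J) P
  low-transfer (below , ordered , sorted) =
    All.map below-transfer below ,
    All.zipWith (λ (lt , o) → subst₂ _<_ (sym (rank-low (<-trans o lt))) (sym (rank-low lt)) o)
                (below , ordered) ,
    sorted-cong (All.map rank-low below) sorted

  high-transfer : ∀ {S} → S.Segment (suc (suc J) ≤_) S → S′.Segment (suc (suc J) ≤_) S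
  high-transfer (above , ordered , sorted) =
    All.map (λ le → subst (suc (suc J) ≤_) (sym (rank-high le)) le) above ,
    All.zipWith (uncurry ≺-high) (above , ordered) ,
    sorted-cong (All.map rank-high above) sorted

  mapMiddle-valid : (μ : MiddleMap s s′ J c₁ c₂) {p : Parts n} →
                    S.ValidParts p → S′.ValidParts (mapMiddle (MiddleMap.apply μ) p)
  mapMiddle-valid μ {parts _ _ _} (S.valid-parts low middle high) =
    S′.valid-parts (low-transfer low) (MiddleMap.valid μ middle) (high-transfer high)

  split-valid : ∀ {g ω f} → IsMonotoneFact s g ω f → S.ValidParts (S.split f)
  split-valid v =
    S.split-valid rank-c₁ rank-c₂ (IsMonotoneFact.ordered v) (IsMonotoneFact.monotone v)

  transport-monotone : (μ : MiddleMap s s′ J c₁ c₂) {g : ℕ} {ω : Permutation′ n} {f : Factorisation n} →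
                       IsMonotoneFact s g ω f → IsMonotoneFact s′ g ω (transport μ f)
  transport-monotone μ {f = f} v = record
    { product  = λ i → trans (prod-cong-middle low high (MiddleMap.preserves-prod μ middle-valid) i)
                             (trans (cong (λ w → prod w ⟨$⟩ʳ i) (S.assemble-split f))
                                    (IsMonotoneFact.product v i))
    ; len      = trans (length-cong-middle low high (MiddleMap.preserves-length μ middle-valid))
                       (trans (cong length (S.assemble-split f)) (IsMonotoneFact.len v))
    ; ordered  = proj₁ (S′.assemble-valid rank′-c₂ rank′-c₁ (mapMiddle-valid μ (split-valid v)))
    ; monotone = proj₂ (S′.assemble-valid rank′-c₂ rank′-c₁ (mapMiddle-valid μ (split-valid v)))
    }
    where
    open Parts (S.split f) using (low; high)
    open S.ValidParts (split-valid v) using (middle-valid)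

  transport-inverse : (μ : MiddleMap s s′ J c₁ c₂) (μ′ : MiddleMap s′ s J c₂ c₁) →
                      (∀ {m} → ValidMiddle (Below s J) c₁ c₂ m →
                               MiddleMap.apply μ′ (MiddleMap.apply μ m) ≡ m) →
                      ∀ {g ω f} → IsMonotoneFact s g ω f → transport μ′ (transport μ f) ≡ f
  transport-inverse μ μ′ μ′∘μ {f = f} v = begin
    assemble (mapMiddle apply′ (S′.split (assemble (mapMiddle apply p))))
      ≡⟨ cong (assemble ∘ mapMiddle apply′)
              (S′.split-assemble rank′-c₂ rank′-c₁ (mapMiddle-valid μ (split-valid v))) ⟩
    assemble (mapMiddle apply′ (mapMiddle apply p))
      ≡⟨ cong (λ m → assemble (parts (Parts.low p) m (Parts.high p)))
              (μ′∘μ (S.ValidParts.middle-valid (split-valid v))) ⟩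
    assemble p
      ≡⟨ S.assemble-split f ⟩
    f ∎
    where
    open ≡-Reasoning
    apply = MiddleMap.apply μ
    apply′ = MiddleMap.apply μ′
    p = S.split f

module MiddleMaps {n} {s s′ : Order n} {J : ℕ} {c₁ c₂ : Fin n}
                  (A : AdjacentOrders s s′ J c₁ c₂) where
  open AdjacentOrders A

  c₁∉Below : ¬ Below s J c₁
  c₁∉Below = <-irrefl rank-c₁

  c₂∉Below : ¬ Below s J c₂
  c₂∉Below lt = <-irrefl refl (<-trans lt (subst (J <_) (sym rank-c₂) (n<1+n J)))

  c₁≢c₂ : c₁ ≢ c₂
  c₁≢c₂ refl = <-irrefl (trans (sym rank-c₁) rank-c₂) (n<1+n J)

  module M = MiddleBijection (Below s J) c₁ c₂ c₁≢c₂ c₁∉Below c₂∉Below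
  open M
  open M public using (from-to)

  below-transfer′ : ∀ {x} → Below s′ J x → Below s J x
  below-transfer′ = Adjacent.below-transfer (adjacent-sym A)

  forward : MiddleMap s s′ J c₁ c₂
  forward = record
    { apply            = to
    ; valid            = ValidMiddle-mono (Adjacent.below-transfer A) ∘ to-valid
    ; preserves-prod   = λ {m} _ → to-prod m
    ; preserves-length = λ {m} _ → to-length m
    }

  backward : MiddleMap s′ s J c₂ c₁
  backward = record
    { apply            = from
    ; valid            = from-valid ∘ ValidMiddle-mono below-transfer′
    ; preserves-prod   = from-prod ∘ ValidMiddle-mono below-transfer′
    ; preserves-length = from-length ∘ ValidMiddle-mono below-transfer′
    }

  forward-backward : ∀ {m} → ValidMiddle (Below s′ J) c₂ c₁ m → to (from m) ≡ m
  forward-backward = to-from ∘ ValidMiddle-mono below-transfer′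

theorem3p1 : (n : ℕ) (ω : Permutation′ n) (g : ℕ) (seq : Order n)
    (j k : Fin n) → toℕ k ≡ suc (toℕ j) →
    Bijection (𝓜 seq g ω) (𝓜 (swapOrder seq j k) g ω)
theorem3p1 n ω g seq j k k≡1+j = Inverse⇒Bijection record
  { to        = λ (f , v) → Λ f , Adjacent.transport-monotone A forward v
  ; from      = λ (f , v) → Λ⁻¹ f , Adjacent.transport-monotone A′ backward v
  ; to-cong   = cong Λ
  ; from-cong = cong Λ⁻¹
  ; inverse   = (λ {(_ , v)} e → trans (cong Λ e) (Λ∘Λ⁻¹ v))
              , (λ {(_ , v)} e → trans (cong Λ⁻¹ e) (Λ⁻¹∘Λ v))
  }
  where
  A  = swapOrder-adjacent seq j k k≡1+j
  A′ = adjacent-sym A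
  open MiddleMaps A
  Λ   = transport forward
  Λ⁻¹ = transport backward
  Λ⁻¹∘Λ : ∀ {f} → IsMonotoneFact seq g ω f → Λ⁻¹ (Λ f) ≡ f
  Λ⁻¹∘Λ = Adjacent.transport-inverse A forward backward from-to
  Λ∘Λ⁻¹ : ∀ {f} → IsMonotoneFact (swapOrder seq j k) g ω f → Λ (Λ⁻¹ f) ≡ f
  Λ∘Λ⁻¹ = Adjacent.transport-inverse A′ backward forward forward-backward
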